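{- Let $n\ge0$ and let $w_1\in\mathbb{N}$ with $w_1\equiv1\pmod2$. Then, for all $x$ (as an identity of polynomials in $x$), \[ C_n(w_1x)=\sum_{l=0}^{w_1-1}(-1)^lC_{n,w_1}\!\left(x+\frac{l}{w_1}\right). \]
   Context: The Catalan polynomials $C_n(x)$ are defined by $\frac{2}{1+\sqrt{1-4t}}(1-4t)^{x/2}=\sum_{n\ge0}C_n(x)t^n$. For $w\in\mathbb{N}$, the $w$-Catalan polynomials $C_{n,w}(x)$ are defined by $\frac{2}{1+(1-4t)^{w/2}}(1-4t)^{\frac{w}{2}x}=\sum_{n\ge0}C_{n,w}(x)t^n$, where $(1-4t)^{a}=\sum_{k\ge0}\binom{a}{k}(-4t)^k$ and $\binom{a}{k}=\frac{a(a-1)\cdots(a-k+1)}{k!}$. -}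

module Defs where

open import Data.Nat as ℕ using (ℕ; zero; suc; _∸_; _≤?_)
open import Data.Integer using (+_; -[1+_])
open import Data.Rational using (ℚ; 0ℚ; 1ℚ; _+_; _*_; _-_; -_; _/_)
open import Relation.Nullary using (yes; no)

ι : ℕ → ℚ
ι k = (+ k) / 1

sumQ : ℕ → (ℕ → ℚ) → ℚ
sumQ zero    f = 0ℚ
sumQ (suc n) f = sumQ n f + f n

binomQ : ℚ → ℕ → ℚ
binomQ a zero    = 1ℚ
binomQ a (suc k) = binomQ a k * (a - ι k) * ((+ 1) / suc k)

negFourPow : ℕ → ℚ
negFourPow zero    = 1ℚ
negFourPow (suc k) = negFourPow k * (-[1+ 3 ] / 1)

-- k-th coefficient of (1-4t)^a = Σ_k binom(a,k) (-4t)^k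
pow1m4 : ℚ → ℕ → ℚ
pow1m4 a k = binomQ a k * negFourPow k

half : ℕ → ℚ
half w = ι w * ((+ 1) / 2)

-- coefficients of D_w(t) = 1 + (1-4t)^{w/2}   (its constant term is 1 + 1 = 2)
dSeries : ℕ → ℕ → ℚ
dSeries w zero    = 1ℚ + pow1m4 (half w) zero
dSeries w (suc k) = pow1m4 (half w) (suc k)

-- coefficients of 1/D_w(t), computed by the standard recursion
-- e_0 = 1/2 (= 1/d_0), e_m = -(1/2) Σ_{j=1}^{m} d_j e_{m-j}.
-- invUpTo w n is a function agreeing with the true coefficients on indices ≤ n.
invUpTo : ℕ → ℕ → (ℕ → ℚ)
invUpTo w zero    m = (+ 1) / 2
invUpTo w (suc n) m with m ≤? n
... | yes _ = invUpTo w n m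
... | no  _ = - ((+ 1) / 2 * sumQ (suc n) (λ i → dSeries w (suc i) * invUpTo w n (n ∸ i)))

invD : ℕ → ℕ → ℚ
invD w n = invUpTo w n n

-- w-Catalan polynomial C_{n,w}(x): n-th coefficient of
-- 2/(1+(1-4t)^{w/2}) · (1-4t)^{(w/2) x}
catW : ℕ → ℚ → ℕ → ℚ
catW w x n = sumQ (suc n) (λ j → ((+ 2) / 1 * invD w j) * pow1m4 (half w * x) (n ∸ j))

-- Catalan polynomial C_n(x): n-th coefficient of 2/(1+sqrt(1-4t)) · (1-4t)^{x/2}
cat : ℚ → ℕ → ℚ
cat x n = sumQ (suc n) (λ j → ((+ 2) / 1 * invD 1 j) * pow1m4 (half 1 * x) (n ∸ j))

signQ : ℕ → ℚ
signQ zero    = 1ℚ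
signQ (suc l) = - signQ l

-- Write s = (1-4t)^{1/2}. Since (1-4t)^{a+b} = (1-4t)^a (1-4t)^b, the generating
-- function of C_{n,w}(x + l/w) is 2/(1 + s^w) · (1-4t)^{wx/2} · s^l, so the alternating
-- sum over l < w has generating function 2/(1 + s^w) · (1-4t)^{wx/2} · Σ_{l<w} (-s)^l.
-- For odd w the telescoping identity (1 + s) Σ_{l<w} (-s)^l = 1 + s^w turns this into
-- 2/(1 + s) · (1-4t)^{wx/2}, the generating function of C_n(wx).

module Submission where

open import Defs
open import Data.Nat as ℕ using (ℕ; zero; suc; _∸_; _≤_; _<_; _≤?_; NonZero; _%_)
import Data.Nat.Properties as ℕₚ
open import Data.Nat.Coprimality using (1-coprimeTo) renaming (sym to coprime-sym)
open import Data.Nat.DivMod using (m≡m%n+[m/n]*n)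
open import Data.Integer as ℤ using (+_; -[1+_])
import Data.Integer.Properties as ℤₚ
open import Data.Rational using (ℚ; mkℚ; 0ℚ; 1ℚ; _+_; _*_; _-_; -_; _/_)
open import Data.Rational.Properties
  using (normalize-coprime; /-cong; *-inverseˡ; +-assoc; *-assoc; *-comm;
         +-identityˡ; +-identityʳ; *-identityˡ; *-identityʳ; *-zeroˡ; *-zeroʳ; *-distribʳ-+)
open import Data.Rational.Solver using (module +-*-Solver)
open +-*-Solver
open import Relation.Nullary using (yes; no)
open import Relation.Nullary.Negation using (contradiction)
open import Relation.Binary.PropositionalEquality

open ≡-Reasoning

ι-coprime : ∀ k → ι k ≡ mkℚ (+ k) 0 (coprime-sym (1-coprimeTo k))
ι-coprime k = normalize-coprime (coprime-sym (1-coprimeTo k))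

1/suc-coprime : ∀ k → (+ 1) / suc k ≡ mkℚ (+ 1) k (1-coprimeTo (suc k))
1/suc-coprime k = normalize-coprime (1-coprimeTo (suc k))

ι-suc : ∀ k → ι (suc k) ≡ 1ℚ + ι k
ι-suc k = trans (/-cong {p₁ = + suc k} {q₁ = 1} {p₂ = + 1 ℤ.+ (+ k) ℤ.* (+ 1)} {q₂ = 1}
                        (cong (ℤ._+_ (+ 1)) (sym (ℤₚ.*-identityʳ (+ k)))) refl)
                (cong (_+_ 1ℚ) (sym (ι-coprime k)))

ι-+ : ∀ m n → ι (m ℕ.+ n) ≡ ι m + ι n
ι-+ zero    n = sym (+-identityˡ (ι n))
ι-+ (suc m) n = begin
  ι (suc (m ℕ.+ n))  ≡⟨ ι-suc (m ℕ.+ n) ⟩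
  1ℚ + ι (m ℕ.+ n)   ≡⟨ cong (_+_ 1ℚ) (ι-+ m n) ⟩
  1ℚ + (ι m + ι n)   ≡⟨ sym (+-assoc 1ℚ (ι m) (ι n)) ⟩
  (1ℚ + ι m) + ι n   ≡⟨ cong (_+ ι n) (sym (ι-suc m)) ⟩
  ι (suc m) + ι n    ∎

1/suc*ι-suc : ∀ k → (+ 1) / suc k * ι (suc k) ≡ 1ℚ
1/suc*ι-suc k rewrite 1/suc-coprime k | ι-coprime (suc k) =
  *-inverseˡ (mkℚ (+ suc k) 0 (coprime-sym (1-coprimeTo (suc k))))

ι-suc-cancelˡ : ∀ k {p q} → ι (suc k) * p ≡ ι (suc k) * q → p ≡ q
ι-suc-cancelˡ k {p} {q} e = begin
  p                        ≡⟨ sym (divide p) ⟩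
  k⁻¹ * (ι (suc k) * p)    ≡⟨ cong (k⁻¹ *_) e ⟩
  k⁻¹ * (ι (suc k) * q)    ≡⟨ divide q ⟩
  q                        ∎
  where
  k⁻¹ = (+ 1) / suc k
  divide : ∀ r → k⁻¹ * (ι (suc k) * r) ≡ r
  divide r = begin
    k⁻¹ * (ι (suc k) * r)  ≡⟨ sym (*-assoc k⁻¹ (ι (suc k)) r) ⟩
    (k⁻¹ * ι (suc k)) * r  ≡⟨ cong (_* r) (1/suc*ι-suc k) ⟩
    1ℚ * r                 ≡⟨ *-identityˡ r ⟩
    r                      ∎

ι*/≡ι : ∀ w l → ι (suc w) * ((+ l) / suc w) ≡ ι l
ι*/≡ι w l = begin
  ι (suc w) * ((+ l) / suc w)         ≡⟨ cong (ι (suc w) *_) l/w≡l*1/w ⟩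
  ι (suc w) * (ι l * w⁻¹)             ≡⟨ solve 3 (λ v m u → v :* (m :* u) := m :* (u :* v)) refl (ι (suc w)) (ι l) w⁻¹ ⟩
  ι l * (w⁻¹ * ι (suc w))             ≡⟨ cong (ι l *_) (1/suc*ι-suc w) ⟩
  ι l * 1ℚ                            ≡⟨ *-identityʳ (ι l) ⟩
  ι l                                 ∎
  where
  w⁻¹ = (+ 1) / suc w
  l/w≡l*1/w : (+ l) / suc w ≡ ι l * w⁻¹
  l/w≡l*1/w = trans
    (/-cong {p₁ = + l} {q₁ = suc w} {p₂ = (+ l) ℤ.* (+ 1)} {q₂ = 1 ℕ.* suc w}
            (sym (ℤₚ.*-identityʳ (+ l))) (sym (ℕₚ.+-identityʳ (suc w))))
    (sym (cong₂ _*_ (ι-coprime l) (1/suc-coprime w)))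

sumQ-cong-< : ∀ n {f g} → (∀ j → j < n → f j ≡ g j) → sumQ n f ≡ sumQ n g
sumQ-cong-< zero    eq = refl
sumQ-cong-< (suc n) eq =
  cong₂ _+_ (sumQ-cong-< n (λ j j<n → eq j (ℕₚ.m<n⇒m<1+n j<n))) (eq n (ℕₚ.n<1+n n))

sumQ-cong : ∀ n {f g} → (∀ j → f j ≡ g j) → sumQ n f ≡ sumQ n g
sumQ-cong n eq = sumQ-cong-< n (λ j _ → eq j)

sumQ-+ : ∀ n f g → sumQ n (λ j → f j + g j) ≡ sumQ n f + sumQ n g
sumQ-+ zero    f g = refl
sumQ-+ (suc n) f g rewrite sumQ-+ n f g =
  solve 4 (λ a b c d → (a :+ b) :+ (c :+ d) := (a :+ c) :+ (b :+ d)) refl (sumQ n f) (sumQ n g) (f n) (g n)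

sumQ-*ˡ : ∀ n c f → sumQ n (λ j → c * f j) ≡ c * sumQ n f
sumQ-*ˡ zero    c f = sym (*-zeroʳ c)
sumQ-*ˡ (suc n) c f rewrite sumQ-*ˡ n c f =
  solve 3 (λ c a b → c :* a :+ c :* b := c :* (a :+ b)) refl c (sumQ n f) (f n)

sumQ-zero : ∀ n → sumQ n (λ _ → 0ℚ) ≡ 0ℚ
sumQ-zero zero = refl
sumQ-zero (suc n) rewrite sumQ-zero n = refl

sumQ-sucˡ : ∀ n f → sumQ (suc n) f ≡ f 0 + sumQ n (λ j → f (suc j))
sumQ-sucˡ zero    f = trans (+-identityˡ (f 0)) (sym (+-identityʳ (f 0)))
sumQ-sucˡ (suc n) f rewrite sumQ-sucˡ n f = +-assoc (f 0) _ _

-- Formal power series over ℚ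

Series : Set
Series = ℕ → ℚ

infix  4 _≋_
infixl 6 _⊕_
infixl 7 _⋆_
infixr 8 _·_
infixl 9 _^ₛ_

_≋_ : Series → Series → Set
f ≋ g = ∀ k → f k ≡ g k

_⊕_ : Series → Series → Series
(f ⊕ g) k = f k + g k

_·_ : ℚ → Series → Series
(c · f) k = c * f k

_⋆_ : Series → Series → Series
(f ⋆ g) n = sumQ (suc n) (λ j → f j * g (n ∸ j))

0ₛ : Series
0ₛ _ = 0ℚ

1ₛ : Series
1ₛ zero    = 1ℚ
1ₛ (suc _) = 0ℚ

tail : Series → Series
tail f k = f (suc k)

-- multiplication by t
shift : Series → Series
shift f zero    = 0ℚ
shift f (suc k) = f k

-- the Euler operator t d/dt
θ : Series → Series
θ f k = ι k * f k

_^ₛ_ : Series → ℕ → Series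
f ^ₛ zero  = 1ₛ
f ^ₛ suc l = f ⋆ f ^ₛ l

sumₛ : ℕ → (ℕ → Series) → Series
sumₛ m F k = sumQ m (λ l → F l k)

shift-cong : ∀ {f g} → f ≋ g → shift f ≋ shift g
shift-cong eq zero    = refl
shift-cong eq (suc k) = eq k

⋆-congˡ : ∀ f {g g′} → g ≋ g′ → f ⋆ g ≋ f ⋆ g′
⋆-congˡ f g≋g′ n = sumQ-cong (suc n) (λ j → cong (f j *_) (g≋g′ (n ∸ j)))

⋆-congʳ : ∀ g {f f′} → f ≋ f′ → f ⋆ g ≋ f′ ⋆ g
⋆-congʳ g f≋f′ n = sumQ-cong (suc n) (λ j → cong (_* g (n ∸ j)) (f≋f′ j))

⋆-sucˡ : ∀ f g n → (f ⋆ g) (suc n) ≡ f 0 * g (suc n) + (tail f ⋆ g) n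
⋆-sucˡ f g n = sumQ-sucˡ (suc n) (λ j → f j * g (suc n ∸ j))

⋆-sucʳ : ∀ f g n → (f ⋆ g) (suc n) ≡ (f ⋆ tail g) n + f (suc n) * g 0
⋆-sucʳ f g n =
  cong₂ _+_ (sumQ-cong-< (suc n) (λ j j<1+n → cong (λ i → f j * g i) (ℕₚ.+-∸-assoc 1 (ℕₚ.≤-pred j<1+n))))
            (cong (λ i → f (suc n) * g i) (ℕₚ.n∸n≡0 n))

⋆-comm : ∀ f g → f ⋆ g ≋ g ⋆ f
⋆-comm f g zero    = cong (_+_ 0ℚ) (*-comm (f 0) (g 0))
⋆-comm f g (suc n) = begin
  (f ⋆ g) (suc n)                       ≡⟨ ⋆-sucˡ f g n ⟩
  f 0 * g (suc n) + (tail f ⋆ g) n      ≡⟨ cong (_+_ (f 0 * g (suc n))) (⋆-comm (tail f) g n) ⟩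
  f 0 * g (suc n) + (g ⋆ tail f) n      ≡⟨ solve 3 (λ a b c → a :* b :+ c := c :+ b :* a) refl (f 0) (g (suc n)) ((g ⋆ tail f) n) ⟩
  (g ⋆ tail f) n + g (suc n) * f 0      ≡⟨ sym (⋆-sucʳ g f n) ⟩
  (g ⋆ f) (suc n)                       ∎

⋆-distribʳ-⊕ : ∀ f h g → (f ⊕ h) ⋆ g ≋ f ⋆ g ⊕ h ⋆ g
⋆-distribʳ-⊕ f h g n =
  trans (sumQ-cong (suc n) (λ j → *-distribʳ-+ (g (n ∸ j)) (f j) (h j))) (sumQ-+ (suc n) _ _)

⋆-distribˡ-⊕ : ∀ f g h → f ⋆ (g ⊕ h) ≋ f ⋆ g ⊕ f ⋆ h
⋆-distribˡ-⊕ f g h n = begin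
  (f ⋆ (g ⊕ h)) n           ≡⟨ ⋆-comm f (g ⊕ h) n ⟩
  ((g ⊕ h) ⋆ f) n           ≡⟨ ⋆-distribʳ-⊕ g h f n ⟩
  (g ⋆ f) n + (h ⋆ f) n     ≡⟨ cong₂ _+_ (⋆-comm g f n) (⋆-comm h f n) ⟩
  (f ⋆ g) n + (f ⋆ h) n     ∎

·-⋆ : ∀ c f g → (c · f) ⋆ g ≋ c · (f ⋆ g)
·-⋆ c f g n = trans (sumQ-cong (suc n) (λ j → *-assoc c (f j) (g (n ∸ j)))) (sumQ-*ˡ (suc n) c _)

⋆-· : ∀ c f g → f ⋆ (c · g) ≋ c · (f ⋆ g)
⋆-· c f g n = trans (⋆-comm f (c · g) n) (trans (·-⋆ c g f n) (cong (c *_) (⋆-comm g f n)))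

⋆-zeroˡ : ∀ g → 0ₛ ⋆ g ≋ 0ₛ
⋆-zeroˡ g n = trans (sumQ-cong (suc n) (λ j → *-zeroˡ (g (n ∸ j)))) (sumQ-zero (suc n))

⋆-zeroʳ : ∀ g → g ⋆ 0ₛ ≋ 0ₛ
⋆-zeroʳ g n = trans (⋆-comm g 0ₛ n) (⋆-zeroˡ g n)

⋆-identityˡ : ∀ g → 1ₛ ⋆ g ≋ g
⋆-identityˡ g zero    = trans (+-identityˡ _) (*-identityˡ (g 0))
⋆-identityˡ g (suc n) = begin
  (1ₛ ⋆ g) (suc n)              ≡⟨ ⋆-sucˡ 1ₛ g n ⟩
  1ℚ * g (suc n) + (0ₛ ⋆ g) n   ≡⟨ cong₂ _+_ (*-identityˡ (g (suc n))) (⋆-zeroˡ g n) ⟩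
  g (suc n) + 0ℚ                ≡⟨ +-identityʳ (g (suc n)) ⟩
  g (suc n)                     ∎

⋆-identityʳ : ∀ g → g ⋆ 1ₛ ≋ g
⋆-identityʳ g n = trans (⋆-comm g 1ₛ n) (⋆-identityˡ g n)

⋆-assoc : ∀ f g h → (f ⋆ g) ⋆ h ≋ f ⋆ (g ⋆ h)
⋆-assoc f g h zero = solve 3 (λ a b c → con 0ℚ :+ (con 0ℚ :+ a :* b) :* c := con 0ℚ :+ a :* (con 0ℚ :+ b :* c))
                             refl (f 0) (g 0) (h 0)
⋆-assoc f g h (suc n) = begin
  ((f ⋆ g) ⋆ h) (suc n)
    ≡⟨ ⋆-sucˡ (f ⋆ g) h n ⟩
  (f ⋆ g) 0 * h (suc n) + (tail (f ⋆ g) ⋆ h) n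
    ≡⟨ cong (_+_ ((f ⋆ g) 0 * h (suc n))) (⋆-congʳ h (⋆-sucˡ f g) n) ⟩
  (f ⋆ g) 0 * h (suc n) + ((f 0 · tail g ⊕ tail f ⋆ g) ⋆ h) n
    ≡⟨ cong (_+_ ((f ⋆ g) 0 * h (suc n))) (⋆-distribʳ-⊕ (f 0 · tail g) (tail f ⋆ g) h n) ⟩
  (f ⋆ g) 0 * h (suc n) + (((f 0 · tail g) ⋆ h) n + ((tail f ⋆ g) ⋆ h) n)
    ≡⟨ cong₂ (λ u v → (f ⋆ g) 0 * h (suc n) + (u + v)) (·-⋆ (f 0) (tail g) h n) (⋆-assoc (tail f) g h n) ⟩
  (0ℚ + f 0 * g 0) * h (suc n) + (f 0 * (tail g ⋆ h) n + (tail f ⋆ (g ⋆ h)) n)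
    ≡⟨ solve 5 (λ a b c d e → (con 0ℚ :+ a :* b) :* c :+ (a :* d :+ e) := a :* (b :* c :+ d) :+ e)
               refl (f 0) (g 0) (h (suc n)) ((tail g ⋆ h) n) ((tail f ⋆ (g ⋆ h)) n) ⟩
  f 0 * (g 0 * h (suc n) + (tail g ⋆ h) n) + (tail f ⋆ (g ⋆ h)) n
    ≡⟨ cong (λ u → f 0 * u + (tail f ⋆ (g ⋆ h)) n) (sym (⋆-sucˡ g h n)) ⟩
  f 0 * (g ⋆ h) (suc n) + (tail f ⋆ (g ⋆ h)) n
    ≡⟨ sym (⋆-sucˡ f (g ⋆ h) n) ⟩
  (f ⋆ (g ⋆ h)) (suc n) ∎

shift-⋆ : ∀ f g → shift f ⋆ g ≋ shift (f ⋆ g)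
shift-⋆ f g zero    = trans (+-identityˡ _) (*-zeroˡ (g 0))
shift-⋆ f g (suc n) =
  trans (⋆-sucˡ (shift f) g n) (trans (cong (_+ (f ⋆ g) n) (*-zeroˡ (g (suc n)))) (+-identityˡ _))

⋆-shift : ∀ f g → g ⋆ shift f ≋ shift (g ⋆ f)
⋆-shift f g n = trans (⋆-comm g (shift f) n) (trans (shift-⋆ f g n) (shift-cong (⋆-comm f g) n))

⋆-sumₛ : ∀ m B F → B ⋆ sumₛ m F ≋ sumₛ m (λ l → B ⋆ F l)
⋆-sumₛ zero    B F n = ⋆-zeroʳ B n
⋆-sumₛ (suc m) B F n =
  trans (⋆-distribˡ-⊕ B (sumₛ m F) (F m) n) (cong (_+ (B ⋆ F m) n) (⋆-sumₛ m B F n))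

θ-⋆ : ∀ f g → θ (f ⋆ g) ≋ θ f ⋆ g ⊕ f ⋆ θ g
θ-⋆ f g n = begin
  ι n * (f ⋆ g) n
    ≡⟨ sym (sumQ-*ˡ (suc n) (ι n) _) ⟩
  sumQ (suc n) (λ j → ι n * (f j * g (n ∸ j)))
    ≡⟨ sumQ-cong-< (suc n) (λ j j<1+n → split j (ℕₚ.≤-pred j<1+n)) ⟩
  sumQ (suc n) (λ j → (ι j * f j) * g (n ∸ j) + f j * (ι (n ∸ j) * g (n ∸ j)))
    ≡⟨ sumQ-+ (suc n) _ _ ⟩
  (θ f ⋆ g) n + (f ⋆ θ g) n ∎
  where
  split : ∀ j → j ≤ n → ι n * (f j * g (n ∸ j)) ≡ (ι j * f j) * g (n ∸ j) + f j * (ι (n ∸ j) * g (n ∸ j))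
  split j j≤n = begin
    ι n * (f j * g (n ∸ j))
      ≡⟨ cong (λ i → ι i * (f j * g (n ∸ j))) (sym (ℕₚ.m+[n∸m]≡n j≤n)) ⟩
    ι (j ℕ.+ (n ∸ j)) * (f j * g (n ∸ j))
      ≡⟨ cong (_* (f j * g (n ∸ j))) (ι-+ j (n ∸ j)) ⟩
    (ι j + ι (n ∸ j)) * (f j * g (n ∸ j))
      ≡⟨ solve 4 (λ a b c d → (a :+ b) :* (c :* d) := (a :* c) :* d :+ c :* (b :* d)) refl (ι j) (ι (n ∸ j)) (f j) (g (n ∸ j)) ⟩
    (ι j * f j) * g (n ∸ j) + f j * (ι (n ∸ j) * g (n ∸ j)) ∎

-- The binomial series (1-4t)^a

four : ℚ
four = (+ 4) / 1

-- (1 - 4t) F′ = -4a F, multiplied by t and read coefficientwise.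
BinomialODE : ℚ → Series → Set
BinomialODE a F = θ F ≋ shift (four · θ F ⊕ (- (four * a)) · F)

pow1m4-ODE : ∀ a → BinomialODE a (pow1m4 a)
pow1m4-ODE a zero    = refl
pow1m4-ODE a (suc k) = begin
  ι (suc k) * ((B * (a - ι k) * k⁻¹) * (N * m4))
    ≡⟨ solve 6 (λ i v B a t N → i :* ((B :* (a :- t) :* v) :* (N :* con m4)) := (v :* i) :* (B :* (a :- t) :* N :* con m4))
               refl (ι (suc k)) k⁻¹ B a (ι k) N ⟩
  (k⁻¹ * ι (suc k)) * (B * (a - ι k) * N * m4)
    ≡⟨ cong (_* (B * (a - ι k) * N * m4)) (1/suc*ι-suc k) ⟩
  1ℚ * (B * (a - ι k) * N * m4)
    ≡⟨ solve 4 (λ B a t N → con 1ℚ :* (B :* (a :- t) :* N :* con m4) := con four :* (t :* (B :* N)) :+ (:- (con four :* a)) :* (B :* N))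
               refl B a (ι k) N ⟩
  four * (ι k * (B * N)) + (- (four * a)) * (B * N) ∎
  where
  B = binomQ a k
  N = negFourPow k
  k⁻¹ = (+ 1) / suc k
  m4 = -[1+ 3 ] / 1

BinomialODE-unique : ∀ a {F G} → BinomialODE a F → BinomialODE a G → F 0 ≡ G 0 → F ≋ G
BinomialODE-unique a odeF odeG F₀≡G₀ zero    = F₀≡G₀
BinomialODE-unique a odeF odeG F₀≡G₀ (suc k) = ι-suc-cancelˡ k (begin
  ι (suc k) * _                                 ≡⟨ odeF (suc k) ⟩
  four * (ι k * _) + (- (four * a)) * _         ≡⟨ cong₂ (λ u v → four * (ι k * u) + (- (four * a)) * v) IH IH ⟩
  four * (ι k * _) + (- (four * a)) * _         ≡⟨ sym (odeG (suc k)) ⟩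
  ι (suc k) * _                                 ∎)
  where IH = BinomialODE-unique a odeF odeG F₀≡G₀ k

BinomialODE-⋆ : ∀ a b {F G} → BinomialODE a F → BinomialODE b G → BinomialODE (a + b) (F ⋆ G)
BinomialODE-⋆ a b {F} {G} odeF odeG k = begin
  θ (F ⋆ G) k                                  ≡⟨ θ-⋆ F G k ⟩
  (θ F ⋆ G) k + (F ⋆ θ G) k                    ≡⟨ cong₂ _+_ (⋆-congʳ G odeF k) (⋆-congˡ F odeG k) ⟩
  (shift P ⋆ G) k + (F ⋆ shift Q) k            ≡⟨ cong₂ _+_ (shift-⋆ P G k) (⋆-shift Q F k) ⟩
  shift (P ⋆ G) k + shift (F ⋆ Q) k            ≡⟨ combine k ⟩
  shift (four · θ (F ⋆ G) ⊕ (- (four * (a + b))) · (F ⋆ G)) k ∎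
  where
  P = four · θ F ⊕ (- (four * a)) · F
  Q = four · θ G ⊕ (- (four * b)) · G
  combine : ∀ k → shift (P ⋆ G) k + shift (F ⋆ Q) k ≡ shift (four · θ (F ⋆ G) ⊕ (- (four * (a + b))) · (F ⋆ G)) k
  combine zero    = refl
  combine (suc k) = begin
    (P ⋆ G) k + (F ⋆ Q) k
      ≡⟨ cong₂ _+_ (⋆-distribʳ-⊕ (four · θ F) ((- (four * a)) · F) G k) (⋆-distribˡ-⊕ F (four · θ G) ((- (four * b)) · G) k) ⟩
    ((four · θ F) ⋆ G) k + (((- (four * a)) · F) ⋆ G) k + ((F ⋆ (four · θ G)) k + (F ⋆ ((- (four * b)) · G)) k)
      ≡⟨ cong₂ _+_ (cong₂ _+_ (·-⋆ four (θ F) G k) (·-⋆ (- (four * a)) F G k))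
                   (cong₂ _+_ (⋆-· four F (θ G) k) (⋆-· (- (four * b)) F G k)) ⟩
    four * (θ F ⋆ G) k + (- (four * a)) * (F ⋆ G) k + (four * (F ⋆ θ G) k + (- (four * b)) * (F ⋆ G) k)
      ≡⟨ solve 5 (λ u v h a b → con four :* u :+ (:- (con four :* a)) :* h :+ (con four :* v :+ (:- (con four :* b)) :* h)
                                := con four :* (u :+ v) :+ (:- (con four :* (a :+ b))) :* h)
                 refl ((θ F ⋆ G) k) ((F ⋆ θ G) k) ((F ⋆ G) k) a b ⟩
    four * ((θ F ⋆ G) k + (F ⋆ θ G) k) + (- (four * (a + b))) * (F ⋆ G) k
      ≡⟨ cong (λ u → four * u + (- (four * (a + b))) * (F ⋆ G) k) (sym (θ-⋆ F G k)) ⟩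
    four * θ (F ⋆ G) k + (- (four * (a + b))) * (F ⋆ G) k ∎

pow1m4-+ : ∀ a b → pow1m4 (a + b) ≋ pow1m4 a ⋆ pow1m4 b
pow1m4-+ a b = BinomialODE-unique (a + b) (pow1m4-ODE (a + b))
                 (BinomialODE-⋆ a b (pow1m4-ODE a) (pow1m4-ODE b)) refl

binomQ-0-suc : ∀ k → binomQ 0ℚ (suc k) ≡ 0ℚ
binomQ-0-suc zero    = refl
binomQ-0-suc (suc k) rewrite binomQ-0-suc k =
  trans (cong (_* ((+ 1) / suc (suc k))) (*-zeroˡ (0ℚ - ι (suc k)))) (*-zeroˡ ((+ 1) / suc (suc k)))

pow1m4-0 : pow1m4 0ℚ ≋ 1ₛ
pow1m4-0 zero    = refl
pow1m4-0 (suc k) = trans (cong (_* negFourPow (suc k)) (binomQ-0-suc k)) (*-zeroˡ (negFourPow (suc k)))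

pow1m4-cong : ∀ {a b} → a ≡ b → pow1m4 a ≋ pow1m4 b
pow1m4-cong refl k = refl

pow1m4-half : ∀ l → pow1m4 (half l) ≋ pow1m4 (half 1) ^ₛ l
pow1m4-half zero    = pow1m4-0
pow1m4-half (suc l) k = begin
  pow1m4 (half (suc l)) k                       ≡⟨ pow1m4-cong half-suc k ⟩
  pow1m4 (half 1 + half l) k                    ≡⟨ pow1m4-+ (half 1) (half l) k ⟩
  (pow1m4 (half 1) ⋆ pow1m4 (half l)) k         ≡⟨ ⋆-congˡ (pow1m4 (half 1)) (pow1m4-half l) k ⟩
  (pow1m4 (half 1) ⋆ pow1m4 (half 1) ^ₛ l) k    ∎
  where
  ½ = (+ 1) / 2
  half-suc : half (suc l) ≡ half 1 + half l
  half-suc = trans (cong (_* ½) (ι-suc l))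
                   (solve 1 (λ t → (con 1ℚ :+ t) :* con ½ := con 1ℚ :* con ½ :+ t :* con ½) refl (ι l))

-- The coefficients of 1 / (1 + (1-4t)^{w/2})

invD-suc : ∀ w n → invD w (suc n) ≡ - ((+ 1) / 2 * sumQ (suc n) (λ i → dSeries w (suc i) * invUpTo w n (n ∸ i)))
invD-suc w n with suc n ≤? n
... | yes n<n = contradiction n<n (ℕₚ.n≮n n)
... | no  _   = refl

invUpTo-suc : ∀ w n m → m ≤ n → invUpTo w (suc n) m ≡ invUpTo w n m
invUpTo-suc w n m m≤n with m ≤? n
... | yes _   = refl
... | no  m≰n = contradiction m≤n m≰n

invUpTo-+ : ∀ w k m → invUpTo w (k ℕ.+ m) m ≡ invD w m
invUpTo-+ w zero    m = refl
invUpTo-+ w (suc k) m = trans (invUpTo-suc w (k ℕ.+ m) m (ℕₚ.m≤n+m m k)) (invUpTo-+ w k m)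

invUpTo-stable : ∀ w n m → m ≤ n → invUpTo w n m ≡ invD w m
invUpTo-stable w n m m≤n =
  trans (cong (λ i → invUpTo w i m) (sym (ℕₚ.m∸n+n≡m m≤n))) (invUpTo-+ w (n ∸ m) m)

dSeries-⋆-invD : ∀ w → dSeries w ⋆ invD w ≋ 1ₛ
dSeries-⋆-invD w zero    = refl
dSeries-⋆-invD w (suc n) = begin
  (dSeries w ⋆ invD w) (suc n)           ≡⟨ ⋆-sucˡ (dSeries w) (invD w) n ⟩
  dSeries w 0 * invD w (suc n) + Σ       ≡⟨ cong (λ e → dSeries w 0 * e + Σ) (trans (invD-suc w n) (cong (λ u → - ((+ 1) / 2 * u)) (sym Σ≡))) ⟩
  (+ 2) / 1 * (- ((+ 1) / 2 * Σ)) + Σ    ≡⟨ solve 1 (λ s → con ((+ 2) / 1) :* (:- (con ((+ 1) / 2) :* s)) :+ s := con 0ℚ) refl Σ ⟩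
  0ℚ                                     ∎
  where
  Σ = (tail (dSeries w) ⋆ invD w) n
  Σ≡ : Σ ≡ sumQ (suc n) (λ i → dSeries w (suc i) * invUpTo w n (n ∸ i))
  Σ≡ = sumQ-cong (suc n) (λ j → cong (dSeries w (suc j) *_) (sym (invUpTo-stable w n (n ∸ j) (ℕₚ.m∸n≤m n j))))

dSeries-≋ : ∀ w → dSeries w ≋ 1ₛ ⊕ pow1m4 (half w)
dSeries-≋ w zero    = refl
dSeries-≋ w (suc k) = sym (+-identityˡ (pow1m4 (half w) (suc k)))

⋆-inverse-transfer : ∀ {D E D′ E′ T} → D ⋆ E ≋ 1ₛ → D′ ⋆ E′ ≋ 1ₛ → D ⋆ T ≋ D′ → E′ ⋆ T ≋ E
⋆-inverse-transfer {D} {E} {D′} {E′} {T} DE≋1 D′E′≋1 DT≋D′ n = begin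
  (E′ ⋆ T) n                  ≡⟨ sym (⋆-identityˡ (E′ ⋆ T) n) ⟩
  (1ₛ ⋆ (E′ ⋆ T)) n           ≡⟨ ⋆-congʳ (E′ ⋆ T) (λ k → sym (trans (⋆-comm E D k) (DE≋1 k))) n ⟩
  ((E ⋆ D) ⋆ (E′ ⋆ T)) n      ≡⟨ ⋆-assoc E D (E′ ⋆ T) n ⟩
  (E ⋆ (D ⋆ (E′ ⋆ T))) n      ≡⟨ ⋆-congˡ E D[E′T]≋1 n ⟩
  (E ⋆ 1ₛ) n                  ≡⟨ ⋆-identityʳ E n ⟩
  E n                         ∎
  where
  D[E′T]≋1 : D ⋆ (E′ ⋆ T) ≋ 1ₛ
  D[E′T]≋1 k = begin
    (D ⋆ (E′ ⋆ T)) k          ≡⟨ ⋆-congˡ D (⋆-comm E′ T) k ⟩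
    (D ⋆ (T ⋆ E′)) k          ≡⟨ sym (⋆-assoc D T E′ k) ⟩
    ((D ⋆ T) ⋆ E′) k          ≡⟨ ⋆-congʳ E′ DT≋D′ k ⟩
    (D′ ⋆ E′) k               ≡⟨ D′E′≋1 k ⟩
    1ₛ k                      ∎

-- The alternating geometric sum Σ_{l<m} (-s)^l

alternatingSum : Series → ℕ → Series
alternatingSum s m = sumₛ m (λ l → signQ l · s ^ₛ l)

alternatingSum-telescope : ∀ s m → alternatingSum s m ⊕ s ⋆ alternatingSum s m ≋ 1ₛ ⊕ (- signQ m) · s ^ₛ m
alternatingSum-telescope s zero    k =
  trans (cong (_+_ 0ℚ) (⋆-zeroʳ s k)) (solve 1 (λ d → con 0ℚ :+ con 0ℚ := d :+ (:- con 1ℚ) :* d) refl (1ₛ k))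
alternatingSum-telescope s (suc m) k = begin
  T k + c * P + (s ⋆ (T ⊕ c · s ^ₛ m)) k
    ≡⟨ cong (_+_ (T k + c * P)) (trans (⋆-distribˡ-⊕ s T (c · s ^ₛ m) k) (cong (_+_ ((s ⋆ T) k)) (⋆-· c s (s ^ₛ m) k))) ⟩
  T k + c * P + ((s ⋆ T) k + c * P′)
    ≡⟨ solve 5 (λ t c p u p′ → t :+ c :* p :+ (u :+ c :* p′) := (t :+ u) :+ c :* p :+ c :* p′) refl (T k) c P ((s ⋆ T) k) P′ ⟩
  (T k + (s ⋆ T) k) + c * P + c * P′
    ≡⟨ cong (λ u → u + c * P + c * P′) (alternatingSum-telescope s m k) ⟩
  1ₛ k + (- c) * P + c * P + c * P′
    ≡⟨ solve 4 (λ d c p p′ → d :+ (:- c) :* p :+ c :* p :+ c :* p′ := d :+ (:- (:- c)) :* p′) refl (1ₛ k) c P P′ ⟩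
  1ₛ k + (- (- c)) * P′ ∎
  where
  T = alternatingSum s m
  c = signQ m
  P = (s ^ₛ m) k
  P′ = (s ^ₛ suc m) k

signQ-*2 : ∀ q → signQ (q ℕ.* 2) ≡ 1ℚ
signQ-*2 zero    = refl
signQ-*2 (suc q) = trans (solve 1 (λ x → :- (:- x) := x) refl (signQ (q ℕ.* 2))) (signQ-*2 q)

signQ-odd : ∀ w → w % 2 ≡ 1 → signQ w ≡ - 1ℚ
signQ-odd w w%2≡1 = trans (cong signQ (trans (m≡m%n+[m/n]*n w 2) (cong (ℕ._+ (w ℕ./ 2) ℕ.* 2) w%2≡1)))
                          (cong -_ (signQ-*2 (w ℕ./ 2)))

dSeries-factor : ∀ w → w % 2 ≡ 1 → dSeries 1 ⋆ alternatingSum (pow1m4 (half 1)) w ≋ dSeries w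
dSeries-factor w w-odd k = begin
  (dSeries 1 ⋆ T) k                      ≡⟨ ⋆-congʳ T (dSeries-≋ 1) k ⟩
  ((1ₛ ⊕ s) ⋆ T) k                       ≡⟨ ⋆-distribʳ-⊕ 1ₛ s T k ⟩
  (1ₛ ⋆ T) k + (s ⋆ T) k                 ≡⟨ cong (_+ (s ⋆ T) k) (⋆-identityˡ T k) ⟩
  T k + (s ⋆ T) k                        ≡⟨ alternatingSum-telescope s w k ⟩
  1ₛ k + (- signQ w) * (s ^ₛ w) k        ≡⟨ cong₂ (λ c u → 1ₛ k + (- c) * u) (signQ-odd w w-odd) (sym (pow1m4-half w k)) ⟩
  1ₛ k + (- (- 1ℚ)) * pow1m4 (half w) k  ≡⟨ solve 2 (λ a b → a :+ (:- (:- con 1ℚ)) :* b := a :+ b) refl (1ₛ k) (pow1m4 (half w) k) ⟩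
  1ₛ k + pow1m4 (half w) k               ≡⟨ sym (dSeries-≋ w k) ⟩
  dSeries w k                            ∎
  where
  s = pow1m4 (half 1)
  T = alternatingSum s w

invD-⋆-alternatingSum : ∀ w → w % 2 ≡ 1 → invD w ⋆ alternatingSum (pow1m4 (half 1)) w ≋ invD 1
invD-⋆-alternatingSum w w-odd =
  ⋆-inverse-transfer {dSeries 1} {invD 1} {dSeries w} {invD w} {alternatingSum (pow1m4 (half 1)) w}
    (dSeries-⋆-invD 1) (dSeries-⋆-invD w) (dSeries-factor w w-odd)

catW-translate : ∀ w x l → catW (suc w) (x + (+ l) / suc w)
                         ≋ (((+ 2) / 1) · invD (suc w) ⋆ pow1m4 (half (suc w) * x)) ⋆ pow1m4 (half 1) ^ₛ l
catW-translate w x l n = begin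
  (E₂ ⋆ pow1m4 (half (suc w) * (x + (+ l) / suc w))) n        ≡⟨ ⋆-congˡ E₂ (λ k → trans (pow1m4-cong argument k) (pow1m4-+ A (half l) k)) n ⟩
  (E₂ ⋆ (pow1m4 A ⋆ pow1m4 (half l))) n                       ≡⟨ sym (⋆-assoc E₂ (pow1m4 A) (pow1m4 (half l)) n) ⟩
  ((E₂ ⋆ pow1m4 A) ⋆ pow1m4 (half l)) n                       ≡⟨ ⋆-congˡ (E₂ ⋆ pow1m4 A) (pow1m4-half l) n ⟩
  ((E₂ ⋆ pow1m4 A) ⋆ pow1m4 (half 1) ^ₛ l) n                  ∎
  where
  E₂ = ((+ 2) / 1) · invD (suc w)
  ½ = (+ 1) / 2
  A = half (suc w) * x
  argument : half (suc w) * (x + (+ l) / suc w) ≡ A + half l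
  argument = trans (solve 3 (λ v y q → (v :* con ½) :* (y :+ q) := (v :* con ½) :* y :+ (v :* q) :* con ½)
                            refl (ι (suc w)) x ((+ l) / suc w))
                   (cong (λ u → A + u * ½) (ι*/≡ι w l))

mainTheorem6 : (n w₁ : ℕ) → .{{_ : NonZero w₁}} → w₁ % 2 ≡ 1 → (x : ℚ) →
    cat (ι w₁ * x) n ≡ sumQ w₁ (λ l → signQ l * catW w₁ (x + (+ l) / w₁) n)
mainTheorem6 n (suc w) w-odd x = sym (begin
  sumQ (suc w) (λ l → signQ l * catW (suc w) (x + (+ l) / suc w) n)
    ≡⟨ sumQ-cong (suc w) (λ l → trans (cong (signQ l *_) (catW-translate w x l n)) (sym (⋆-· (signQ l) (E ⋆ S) (s ^ₛ l) n))) ⟩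
  sumₛ (suc w) (λ l → (E ⋆ S) ⋆ signQ l · s ^ₛ l) n
    ≡⟨ sym (⋆-sumₛ (suc w) (E ⋆ S) (λ l → signQ l · s ^ₛ l) n) ⟩
  ((E ⋆ S) ⋆ T) n              ≡⟨ ⋆-congʳ T (⋆-comm E S) n ⟩
  ((S ⋆ E) ⋆ T) n              ≡⟨ ⋆-assoc S E T n ⟩
  (S ⋆ (E ⋆ T)) n              ≡⟨ ⋆-congˡ S (λ k → trans (·-⋆ two (invD (suc w)) T k) (cong (two *_) (invD-⋆-alternatingSum (suc w) w-odd k))) n ⟩
  (S ⋆ two · invD 1) n         ≡⟨ ⋆-comm S (two · invD 1) n ⟩
  (two · invD 1 ⋆ S) n         ≡⟨ ⋆-congˡ (two · invD 1) (pow1m4-cong S-argument) n ⟩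
  cat (ι (suc w) * x) n        ∎)
  where
  two = (+ 2) / 1
  s = pow1m4 (half 1)
  T = alternatingSum s (suc w)
  E = two · invD (suc w)
  S = pow1m4 (half (suc w) * x)
  S-argument : half (suc w) * x ≡ half 1 * (ι (suc w) * x)
  S-argument = solve 2 (λ v y → (v :* con ((+ 1) / 2)) :* y := (con 1ℚ :* con ((+ 1) / 2)) :* (v :* y)) refl (ι (suc w)) x
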